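{- Let $G$ be an Eulerian digraph with $n$ vertices and $m \ge 1$ arcs. Then $G$ contains a directed cycle of length at most $6n^2/m$, i.e. $g(G) \le 6n^2/m$.
   Context: All digraphs are finite and simple: no loops and no multiple arcs, but two arcs in opposite directions between the same pair of vertices are allowed (so a directed cycle may have length $2$). A digraph is Eulerian if every vertex has in-degree equal to its out-degree. The girth $g(G)$ is the length of a shortest directed cycle in $G$. -}

module Defs where

open import Data.Nat using (ℕ; suc; _%_)
open import Data.Bool using (Bool; true; false)
open import Data.Fin using (Fin; toℕ; fromℕ<)
open import Data.Nat.DivMod using (m%n<n)
open import Data.List using (List; map)
open import Data.Nat.ListAction using (sum)
import Data.List
open import Function.Definitions using (Injective)
open import Relation.Binary.PropositionalEquality using (_≡_)

-- A finite simple digraph on vertex set Fin n: an adjacency relation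
-- (arc u → v iff adj u v ≡ true) with no loops. Antiparallel arcs allowed;
-- multiple arcs impossible by construction.
record Digraph (n : ℕ) : Set where
  field
    adj     : Fin n → Fin n → Bool
    loopless : ∀ v → adj v v ≡ false
open Digraph public

Σfin : (n : ℕ) → (Fin n → ℕ) → ℕ
Σfin n f = sum (map f (Data.List.allFin n))

arcInd : Bool → ℕ
arcInd true  = 1
arcInd false = 0

outdeg : ∀ {n} → Digraph n → Fin n → ℕ
outdeg {n} G u = Σfin n (λ v → arcInd (adj G u v))

indeg : ∀ {n} → Digraph n → Fin n → ℕ
indeg {n} G v = Σfin n (λ u → arcInd (adj G u v))

arcs : ∀ {n} → Digraph n → ℕ
arcs {n} G = Σfin n (outdeg G)

Eulerian : ∀ {n} → Digraph n → Set
Eulerian G = ∀ v → indeg G v ≡ outdeg G v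

next : ∀ {k} → Fin (suc k) → Fin (suc k)
next {k} i = fromℕ< (m%n<n (suc (toℕ i)) (suc k))

-- A directed cycle of length suc k: distinct vertices c 0, …, c k with
-- arcs c i → c (i+1 mod (k+1)); length ≥ 2 is forced by looplessness.
record DirectedCycle {n : ℕ} (G : Digraph n) (len : ℕ) : Set where
  field
    k       : ℕ
    len≡    : len ≡ suc k
    vertex  : Fin (suc k) → Fin n
    distinct : Injective _≡_ _≡_ vertex
    arc     : ∀ i → adj G (vertex i) (vertex (next i)) ≡ true

module Submission where

-- Let B_i(v) be the set of vertices reachable from v by a walk of length at
-- most i, and suppose G has no closed walk of length at most k + 1.  Count,
-- for every vertex v, the pairs (radius i ≤ k, arc x → y) such that the arc
-- enters B_i(v), i.e. y ∈ B_i(v) and x ∉ B_i(v).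
--  * Upper bound.  In an Eulerian digraph as many arcs enter a vertex set as
--    leave it, and an arc leaves the growing balls B_0(v) ⊆ B_1(v) ⊆ … at
--    most once; so the count for v is at most m and the total at most n·m.
--  * Lower bound.  Group the pairs by the head y of the arc.  The arc x → y
--    enters every ball around y, and for distinct in-neighbours x, v of y the
--    arcs x → y and v → y together enter the balls around v resp. x at least
--    k − 1 times; so the pairs with head y number at least (k − 1)·d⁻(y)²/2.
-- With Cauchy–Schwarz, m² ≤ n·Σ_y d⁻(y)², this gives (k − 1)·m ≤ 2n².  For
-- k = ⌊2n²/m⌋ + 2 that is false, so G has a closed walk of length at most
-- ⌊2n²/m⌋ + 3, a shortest closed walk inside it is a directed cycle, and
-- (⌊2n²/m⌋ + 3)·m ≤ 5n².

open import Defs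
open import Data.Nat using (ℕ; zero; suc; _+_; _*_; _∸_; _≤_; _<_; z≤n; s≤s; s≤s⁻¹; NonZero; >-nonZero)
open import Data.Nat.Properties
open import Data.Nat.DivMod using (_/_; _%_; m/n*n≤m; m≡m%n+[m/n]*n; m%n<n; m<n⇒m%n≡m; n%n≡0)
open import Data.Nat.Induction using (<-rec)
open import Data.Nat.Tactic.RingSolver using (solve-∀)
open import Data.Bool using (Bool; true; false; _∧_; not)
open import Data.Bool.Properties using (∧-comm) renaming (_≟_ to _≟ᵇ_)
open import Data.Fin as Fin using (Fin; zero; suc; toℕ)
import Data.Fin.Properties as Fin
open import Data.Fin.Permutation using (reverse)
open import Data.List using (map; tabulate)
open import Data.List.Properties using (map-tabulate)
open import Data.Nat.ListAction using () renaming (sum to listSum)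
open import Data.Product using (∃; ∃₂; _×_; _,_)
open import Data.Sum using (_⊎_; inj₁; inj₂)
open import Data.Empty using (⊥; ⊥-elim)
open import Function using (_∘_; id)
open import Function.Definitions using (Injective)
open import Relation.Binary.Definitions using (tri<; tri≈; tri>)
open import Relation.Nullary using (Dec; yes; no; ¬_; does; contradiction)
open import Relation.Nullary.Decidable using (_×-dec_; dec-true; dec-false)
open import Relation.Binary.PropositionalEquality
open import Algebra.Properties.Semiring.Sum +-*-semiring
  using (sum; sum-syntax; ∑-distrib-+; ∑-comm; *-distribˡ-sum; *-distribʳ-sum; sum-cong-≗; sum-permute)

Σfin≡∑ : ∀ n (f : Fin n → ℕ) → Σfin n f ≡ ∑[ i < n ] f i
Σfin≡∑ zero    f = refl
Σfin≡∑ (suc n) f = cong (f zero +_) (begin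
  listSum (map f (tabulate suc))   ≡⟨ cong listSum (map-tabulate suc f) ⟩
  listSum (tabulate (f ∘ suc))     ≡⟨ cong listSum (map-tabulate id (f ∘ suc)) ⟨
  Σfin n (f ∘ suc)                 ≡⟨ Σfin≡∑ n (f ∘ suc) ⟩
  ∑[ i < n ] f (suc i)             ∎)
  where open ≡-Reasoning

∑-mono-≤ : ∀ {n} {f g : Fin n → ℕ} → (∀ i → f i ≤ g i) → sum f ≤ sum g
∑-mono-≤ {zero}  _   = z≤n
∑-mono-≤ {suc n} f≤g = +-mono-≤ (f≤g zero) (∑-mono-≤ (f≤g ∘ suc))

∑-const : ∀ n c → ∑[ i < n ] c ≡ n * c
∑-const zero    c = refl
∑-const (suc n) c = cong (c +_) (∑-const n c)

∑-ones : ∀ L → ∑[ i < L ] 1 ≡ L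
∑-ones L = trans (∑-const L 1) (*-identityʳ L)

∑∑-distrib-+ : ∀ {a b} (f g : Fin a → Fin b → ℕ) →
               ∑[ x < a ] ∑[ y < b ] (f x y + g x y)
               ≡ ∑[ x < a ] ∑[ y < b ] f x y + ∑[ x < a ] ∑[ y < b ] g x y
∑∑-distrib-+ {b = b} f g = trans (sum-cong-≗ (λ x → ∑-distrib-+ (f x) (g x)))
                                 (∑-distrib-+ (λ x → ∑[ y < b ] f x y) (λ x → ∑[ y < b ] g x y))

∑-rotate : ∀ {a b c} (f : Fin a → Fin b → Fin c → ℕ) →
           ∑[ x < a ] ∑[ y < b ] ∑[ z < c ] f x y z ≡ ∑[ z < c ] ∑[ x < a ] ∑[ y < b ] f x y z
∑-rotate {b = b} f = trans (sum-cong-≗ (λ x → ∑-comm (f x))) (∑-comm (λ x z → ∑[ y < b ] f x y z))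

∑-reverse : ∀ L (h : ℕ → ℕ) → ∑[ i < L ] h (L ∸ suc (toℕ i)) ≡ ∑[ i < L ] h (toℕ i)
∑-reverse L h = sym (trans (sum-permute {L} {L} (h ∘ toℕ) reverse)
                           (sum-cong-≗ {L} (λ i → cong h (Fin.opposite-prop i))))

private
  +-exchange : ∀ a b c → a + (b + c) ≡ b + (a + c)
  +-exchange = solve-∀

  *-exchange : ∀ a b c → a * (b * c) ≡ b * (a * c)
  *-exchange = solve-∀

∑-single-out : ∀ {n} {f g : Fin n → ℕ} (x : Fin n) →
               (∀ i → f i ≤ g i) → f x ≡ 0 → g x + sum f ≤ sum g
∑-single-out {f = f} zero f≤g fx≡0 rewrite fx≡0 = +-monoʳ-≤ _ (∑-mono-≤ (f≤g ∘ suc))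
∑-single-out {f = f} {g} (suc x) f≤g fx≡0 = begin
  g (suc x) + (f zero + sum (f ∘ suc))   ≡⟨ +-exchange (g (suc x)) (f zero) _ ⟩
  f zero + (g (suc x) + sum (f ∘ suc))   ≤⟨ +-mono-≤ (f≤g zero) (∑-single-out x (f≤g ∘ suc) fx≡0) ⟩
  g zero + sum (g ∘ suc)                 ∎
  where open ≤-Reasoning

∑-except : ∀ {n} {f g : Fin n → ℕ} (x : Fin n) →
           (∀ i → i ≢ x → f i ≤ g i) → sum f ≤ f x + sum g
∑-except {f = f} {g} zero f≤g =
  +-monoʳ-≤ (f zero) (≤-trans (∑-mono-≤ (λ i → f≤g (suc i) λ ())) (m≤n+m _ (g zero)))
∑-except {f = f} {g} (suc x) f≤g = begin
  f zero + sum (f ∘ suc)                 ≤⟨ +-mono-≤ (f≤g zero λ ()) (∑-except x f≤g-on-tail) ⟩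
  g zero + (f (suc x) + sum (g ∘ suc))   ≡⟨ +-exchange (g zero) (f (suc x)) _ ⟩
  f (suc x) + (g zero + sum (g ∘ suc))   ∎
  where
  open ≤-Reasoning
  f≤g-on-tail : ∀ i → i ≢ x → f (suc i) ≤ g (suc i)
  f≤g-on-tail i i≢x = f≤g (suc i) (i≢x ∘ Fin.suc-injective)

telescope : ∀ L (h g : ℕ → ℕ) → (∀ i → h i + g i ≤ g (suc i)) → ∑[ i < L ] h (toℕ i) + g 0 ≤ g L
telescope zero    h g step = ≤-refl
telescope (suc L) h g step = begin
  h 0 + H + g 0      ≡⟨ cong (_+ g 0) (+-comm (h 0) H) ⟩
  H + h 0 + g 0      ≡⟨ +-assoc H (h 0) (g 0) ⟩
  H + (h 0 + g 0)    ≤⟨ +-monoʳ-≤ H (step 0) ⟩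
  H + g 1            ≤⟨ telescope L (h ∘ suc) (g ∘ suc) (step ∘ suc) ⟩
  g (suc L)          ∎
  where
  open ≤-Reasoning
  H = ∑[ i < L ] h (suc (toℕ i))

private
  2ab≤a²+b²-ordered : ∀ a k → 2 * (a * (a + k)) ≤ a * a + (a + k) * (a + k)
  2ab≤a²+b²-ordered a k = subst (2 * (a * (a + k)) ≤_) (sym (expand a k)) (m≤m+n _ (k * k))
    where
    expand : ∀ a k → a * a + (a + k) * (a + k) ≡ 2 * (a * (a + k)) + k * k
    expand = solve-∀

-- 2ab ≤ a² + b² over ℕ: writing the larger number as the smaller plus k,
-- the two sides differ by k².
2ab≤a²+b² : ∀ a b → 2 * (a * b) ≤ a * a + b * b
2ab≤a²+b² a b with ≤-total a b
... | inj₁ a≤b with m≤n⇒∃[o]m+o≡n a≤b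
...   | k , refl = 2ab≤a²+b²-ordered a k
2ab≤a²+b² a b | inj₂ b≤a with m≤n⇒∃[o]m+o≡n b≤a
...   | k , refl = subst₂ _≤_ (cong (2 *_) (*-comm b a)) (+-comm (b * b) (a * a)) (2ab≤a²+b²-ordered b k)

square-∑ : ∀ {n} (f : Fin n → ℕ) → sum f * sum f ≡ ∑[ i < n ] ∑[ j < n ] (f i * f j)
square-∑ f = trans (*-distribʳ-sum (sum f) f) (sum-cong-≗ (λ i → *-distribˡ-sum (f i) f))

-- Cauchy–Schwarz: (∑ f)² ≤ n ∑ f², by summing 2 f(i) f(j) ≤ f(i)² + f(j)²
-- over all pairs (i, j).
cauchy-schwarz : ∀ n (f : Fin n → ℕ) → sum f * sum f ≤ n * ∑[ i < n ] (f i * f i)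
cauchy-schwarz n f = *-cancelˡ-≤ 2 (begin
  2 * (sum f * sum f)                                ≡⟨ cong (2 *_) (square-∑ f) ⟩
  2 * ∑[ i < n ] ∑[ j < n ] (f i * f j)              ≡⟨ double ⟩
  ∑[ i < n ] ∑[ j < n ] (2 * (f i * f j))            ≤⟨ ∑-mono-≤ (λ i → ∑-mono-≤ (λ j → 2ab≤a²+b² (f i) (f j))) ⟩
  ∑[ i < n ] ∑[ j < n ] (f i * f i + f j * f j)      ≡⟨ ∑∑-distrib-+ (λ i _ → f i * f i) (λ _ j → f j * f j) ⟩
  ∑[ i < n ] ∑[ j < n ] (f i * f i) + ∑[ i < n ] Q   ≡⟨ cong₂ _+_ (sum-cong-≗ (λ i → ∑-const n (f i * f i))) (∑-const n Q) ⟩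
  ∑[ i < n ] (n * (f i * f i)) + n * Q               ≡⟨ cong (_+ n * Q) (*-distribˡ-sum n (λ i → f i * f i)) ⟨
  n * Q + n * Q                                      ≡⟨ cong (n * Q +_) (+-identityʳ (n * Q)) ⟨
  2 * (n * Q)                                        ∎)
  where
  open ≤-Reasoning
  Q = ∑[ i < n ] (f i * f i)
  double : 2 * ∑[ i < n ] ∑[ j < n ] (f i * f j) ≡ ∑[ i < n ] ∑[ j < n ] (2 * (f i * f j))
  double = trans (*-distribˡ-sum 2 (λ i → ∑[ j < n ] (f i * f j)))
                 (sum-cong-≗ (λ i → *-distribˡ-sum 2 (λ j → f i * f j)))

cancel-factor : ∀ a b m → a * m * m ≤ b * m → a * m ≤ b
cancel-factor a b zero    _  = subst (_≤ b) (sym (*-zeroʳ a)) z≤n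
cancel-factor a b (suc m) le = *-cancelʳ-≤ (a * suc m) b (suc m) le

a<[1+a/m]*m : ∀ a m .{{_ : NonZero m}} → a < suc (a / m) * m
a<[1+a/m]*m a m = begin-strict
  a                    ≡⟨ m≡m%n+[m/n]*n a m ⟩
  a % m + a / m * m    <⟨ +-monoˡ-< (a / m * m) (m%n<n a m) ⟩
  suc (a / m) * m      ∎
  where open ≤-Reasoning

collision-or-injective : ∀ {a b} (f : Fin a → Fin b) →
                         (∃₂ λ i j → i Fin.< j × f i ≡ f j) ⊎ Injective _≡_ _≡_ f
collision-or-injective f with Fin.any? (λ i → Fin.any? (λ j → (i Fin.<? j) ×-dec (f i Fin.≟ f j)))
... | yes (i , j , i<j , fi≡fj) = inj₁ (i , j , i<j , fi≡fj)
... | no no-collision = inj₂ injective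
  where
  injective : Injective _≡_ _≡_ f
  injective {i} {j} fi≡fj with Fin.<-cmp i j
  ... | tri< i<j _ _ = contradiction (i , j , i<j , fi≡fj) no-collision
  ... | tri≈ _ i≡j _ = i≡j
  ... | tri> _ _ j<i = contradiction (j , i , j<i , sym fi≡fj) no-collision

𝟙 : Bool → ℕ
𝟙 = arcInd

𝟙≤1 : ∀ b → 𝟙 b ≤ 1
𝟙≤1 true  = ≤-refl
𝟙≤1 false = z≤n

𝟙-not+𝟙 : ∀ b → 𝟙 (not b) + 𝟙 b ≡ 1
𝟙-not+𝟙 true  = refl
𝟙-not+𝟙 false = refl

𝟙-weight≤ : ∀ b c → 𝟙 b * c ≤ c
𝟙-weight≤ true  c = ≤-reflexive (+-identityʳ c)
𝟙-weight≤ false c = z≤n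

𝟙-split : ∀ c b e → c * 𝟙 b ≡ c * 𝟙 (b ∧ e) + c * 𝟙 (b ∧ not e)
𝟙-split c true  true  rewrite *-zeroʳ c = sym (+-identityʳ _)
𝟙-split c true  false rewrite *-zeroʳ c = refl
𝟙-split c false e     rewrite *-zeroʳ c = refl

module Walks {n : ℕ} (G : Digraph n) where

  Arc : Fin n → Fin n → Set
  Arc x y = adj G x y ≡ true

  CycleWithin : ℕ → Set
  CycleWithin ℓmax = ∃ λ ℓ → DirectedCycle G ℓ × ℓ ≤ ℓmax

  -- Reach i v x: there is a walk from v to x of length at most i.
  data Reach : ℕ → Fin n → Fin n → Set where
    here : ∀ {i v} → Reach i v v
    step : ∀ {i v y x} → Arc v y → Reach i y x → Reach (suc i) v x

  reach-weaken : ∀ {i j v x} → i ≤ j → Reach i v x → Reach j v x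
  reach-weaken _         here       = here
  reach-weaken (s≤s i≤j) (step a r) = step a (reach-weaken i≤j r)

  reach-trans : ∀ {i j v x z} → Reach i v x → Reach j x z → Reach (i + j) v z
  reach-trans {i} {j} here r = reach-weaken (m≤n+m j i) r
  reach-trans (step a r) r′  = step a (reach-trans r r′)

  reach-snoc : ∀ {i v x y} → Reach i v x → Arc x y → Reach (suc i) v y
  reach-snoc here       a = step a here
  reach-snoc (step b r) a = step b (reach-snoc r a)

  reach? : ∀ i v x → Dec (Reach i v x)
  reach? i v x with v Fin.≟ x
  ... | yes refl = yes here
  reach? zero    v x | no v≢x = no λ { here → v≢x refl }
  reach? (suc i) v x | no v≢x with Fin.any? (λ y → (adj G v y ≟ᵇ true) ×-dec reach? i y x)
  ... | yes (y , a , r) = yes (step a r)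
  ... | no ¬step        = no λ { here → v≢x refl ; (step a r) → ¬step (_ , a , r) }

  -- A closed walk of length suc k: vertices w 0, …, w (suc k) = w 0.
  record ClosedWalk (k : ℕ) : Set where
    field
      vertex : ℕ → Fin n
      arc    : ∀ i → i ≤ k → Arc (vertex i) (vertex (suc i))
      closed : vertex (suc k) ≡ vertex 0

  route : ∀ {i v x} → Reach i v x → ℕ → Fin n
  route {v = v} here       _       = v
  route {v = v} (step a r) zero    = v
  route         (step a r) (suc t) = route r t

  length : ∀ {i v x} → Reach i v x → ℕ
  length here       = 0
  length (step a r) = suc (length r)

  length≤ : ∀ {i v x} (r : Reach i v x) → length r ≤ i
  length≤ here       = z≤n
  length≤ (step a r) = s≤s (length≤ r)

  route-start : ∀ {i v x} (r : Reach i v x) → route r 0 ≡ v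
  route-start here       = refl
  route-start (step a r) = refl

  route-end : ∀ {i v x} (r : Reach i v x) → route r (length r) ≡ x
  route-end here       = refl
  route-end (step a r) = route-end r

  route-arc : ∀ {i v x} (r : Reach i v x) t → t < length r → Arc (route r t) (route r (suc t))
  route-arc (step {v = v} a r) zero    _         = subst (Arc v) (sym (route-start r)) a
  route-arc (step a r)         (suc t) (s≤s t<ℓ) = route-arc r t t<ℓ

  close-up : ∀ {j v y} → Arc v y → (r : Reach j y v) → ClosedWalk (length r)
  close-up a r = record
    { vertex = route (step a r)
    ; arc    = λ i i≤ℓ → route-arc (step a r) i (s≤s i≤ℓ)
    ; closed = route-end r }

  shortcut : ∀ {k} (w : ClosedWalk k) {p q} → p < q → q ≤ k →
             ClosedWalk.vertex w p ≡ ClosedWalk.vertex w q → ∃ λ k′ → k′ < k × ClosedWalk k′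
  shortcut {k} w {p} p<q q≤k wp≡wq with m≤n⇒∃[o]m+o≡n p<q
  ... | k′ , refl = k′ , ≤-trans (s≤s (m≤n+m k′ p)) q≤k ,
                    record { vertex = vertex ∘ (p +_) ; arc = inner-arc ; closed = inner-closed }
    where
    open ClosedWalk w
    inner-arc : ∀ i → i ≤ k′ → Arc (vertex (p + i)) (vertex (p + suc i))
    inner-arc i i≤k′ = subst (Arc (vertex (p + i)) ∘ vertex) (sym (+-suc p i))
                             (arc (p + i) (≤-trans (+-monoʳ-≤ p i≤k′) (≤-trans (n≤1+n _) q≤k)))
    inner-closed : vertex (p + suc k′) ≡ vertex (p + 0)
    inner-closed = trans (cong vertex (+-suc p k′)) (trans (sym wp≡wq) (cong vertex (sym (+-identityʳ p))))

  next-toℕ : ∀ {k} (i : Fin (suc k)) → toℕ i < k → toℕ (next i) ≡ suc (toℕ i)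
  next-toℕ i i<k = trans (Fin.toℕ-fromℕ< _) (m<n⇒m%n≡m (s≤s i<k))

  next-toℕ-last : ∀ {k} (i : Fin (suc k)) → toℕ i ≡ k → toℕ (next i) ≡ 0
  next-toℕ-last {k} i i≡k =
    trans (Fin.toℕ-fromℕ< _) (trans (cong (λ j → suc j % suc k) i≡k) (n%n≡0 (suc k)))

  as-cycle : ∀ {k} (w : ClosedWalk k) → Injective _≡_ _≡_ (ClosedWalk.vertex w ∘ toℕ {suc k}) →
             DirectedCycle G (suc k)
  as-cycle {k} w injective = record
    { k = k ; len≡ = refl ; vertex = vertex ∘ toℕ ; distinct = injective ; arc = cycle-arc }
    where
    open ClosedWalk w
    cycle-arc : ∀ i → Arc (vertex (toℕ i)) (vertex (toℕ (next i)))
    cycle-arc i with m<1+n⇒m<n∨m≡n (Fin.toℕ<n i)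
    ... | inj₁ i<k rewrite next-toℕ i i<k = arc (toℕ i) (<⇒≤ i<k)
    ... | inj₂ i≡k rewrite next-toℕ-last i i≡k =
      subst (Arc (vertex (toℕ i))) (trans (cong (vertex ∘ suc) i≡k) closed) (arc (toℕ i) (≤-reflexive i≡k))

  -- Every closed walk of length suc k contains a directed cycle of length
  -- at most suc k: shortcut repeated vertices until there are none.
  cycle-within : ∀ k → ClosedWalk k → CycleWithin (suc k)
  cycle-within = <-rec _ extract
    where
    extract : ∀ k → (∀ {k′} → k′ < k → ClosedWalk k′ → CycleWithin (suc k′)) → ClosedWalk k → CycleWithin (suc k)
    extract k shorter w with collision-or-injective (ClosedWalk.vertex w ∘ toℕ {suc k})
    ... | inj₂ injective = suc k , as-cycle w injective , ≤-refl
    ... | inj₁ (i , j , i<j , wi≡wj) with shortcut w i<j (s≤s⁻¹ (Fin.toℕ<n j)) wi≡wj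
    ...   | k′ , k′<k , w′ with shorter k′<k w′
    ...     | ℓ , cycle , ℓ≤ = ℓ , cycle , ≤-trans ℓ≤ (s≤s (<⇒≤ k′<k))

module Counting {n : ℕ} (G : Digraph n) where
  open Walks G

  A : Fin n → Fin n → ℕ
  A x y = 𝟙 (adj G x y)

  arcCount : ℕ
  arcCount = ∑[ x < n ] ∑[ y < n ] A x y

  d⁺ d⁻ : Fin n → ℕ
  d⁺ x = ∑[ y < n ] A x y
  d⁻ y = ∑[ x < n ] A x y

  arcs≡arcCount : arcs G ≡ arcCount
  arcs≡arcCount = trans (Σfin≡∑ n (outdeg G)) (sum-cong-≗ (λ x → Σfin≡∑ n (A x)))

  eulerian-degrees : Eulerian G → ∀ v → d⁻ v ≡ d⁺ v
  eulerian-degrees eul v = trans (sym (Σfin≡∑ n (λ x → A x v))) (trans (eul v) (Σfin≡∑ n (A v)))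

  ∑d⁻≡arcCount : ∑[ y < n ] d⁻ y ≡ arcCount
  ∑d⁻≡arcCount = ∑-comm (λ y x → A x y)

  arcs≤n² : arcs G ≤ n * n
  arcs≤n² = begin
    arcs G                           ≡⟨ arcs≡arcCount ⟩
    arcCount                         ≤⟨ ∑-mono-≤ (λ x → ∑-mono-≤ (λ y → 𝟙≤1 (adj G x y))) ⟩
    ∑[ x < n ] ∑[ y < n ] 1          ≡⟨ trans (sum-cong-≗ {n} (λ _ → ∑-const n 1)) (∑-const n (n * 1)) ⟩
    n * (n * 1)                      ≡⟨ cong (n *_) (*-identityʳ n) ⟩
    n * n                            ∎
    where open ≤-Reasoning

  arc-weight-≤ : ∀ {x y c d} → (Arc x y → c ≤ d) → A x y * c ≤ A x y * d
  arc-weight-≤ {x} {y} c≤d with adj G x y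
  ... | true  = *-monoʳ-≤ 1 (c≤d refl)
  ... | false = z≤n

  arc-weight : ∀ {x y} c → Arc x y → A x y * c ≡ c
  arc-weight c xy rewrite xy = +-identityʳ c

  arcsWith : (Fin n → Fin n → Bool) → ℕ
  arcsWith P = ∑[ x < n ] ∑[ y < n ] (A x y * 𝟙 (P x y))

  arcsWith-split : ∀ (P Q : Fin n → Fin n → Bool) →
                   arcsWith P ≡ arcsWith (λ x y → P x y ∧ Q x y) + arcsWith (λ x y → P x y ∧ not (Q x y))
  arcsWith-split P Q =
    trans (sum-cong-≗ {n} (λ x → sum-cong-≗ {n} (λ y → 𝟙-split (A x y) (P x y) (Q x y))))
          (∑∑-distrib-+ (λ x y → A x y * 𝟙 (P x y ∧ Q x y)) (λ x y → A x y * 𝟙 (P x y ∧ not (Q x y))))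

  entering leaving inside : (Fin n → Bool) → ℕ
  entering s = arcsWith (λ x y → s y ∧ not (s x))
  leaving  s = arcsWith (λ x y → s x ∧ not (s y))
  inside   s = arcsWith (λ x y → s x ∧ s y)

  -- Cut balance: in an Eulerian digraph as many arcs enter a vertex set s as
  -- leave it, since adding the arcs inside s to either gives Σ_{x ∈ s} d(x).
  balance : Eulerian G → ∀ s → entering s ≡ leaving s
  balance eul s = +-cancelˡ-≡ (inside s) _ _ (begin
    inside s + entering s              ≡⟨ in-split ⟨
    ∑[ y < n ] (d⁻ y * 𝟙 (s y))        ≡⟨ sum-cong-≗ (λ y → cong (_* 𝟙 (s y)) (eulerian-degrees eul y)) ⟩
    ∑[ x < n ] (d⁺ x * 𝟙 (s x))        ≡⟨ out-split ⟩
    inside s + leaving s               ∎)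
    where
    open ≡-Reasoning
    out-split : ∑[ x < n ] (d⁺ x * 𝟙 (s x)) ≡ inside s + leaving s
    out-split = begin
      ∑[ x < n ] (d⁺ x * 𝟙 (s x))                  ≡⟨ sum-cong-≗ (λ x → *-distribʳ-sum (𝟙 (s x)) (A x)) ⟩
      arcsWith (λ x _ → s x)                       ≡⟨ arcsWith-split (λ x _ → s x) (λ _ y → s y) ⟩
      inside s + leaving s                         ∎
    in-split : ∑[ y < n ] (d⁻ y * 𝟙 (s y)) ≡ inside s + entering s
    in-split = begin
      ∑[ y < n ] (d⁻ y * 𝟙 (s y))                  ≡⟨ sum-cong-≗ (λ y → *-distribʳ-sum (𝟙 (s y)) (λ x → A x y)) ⟩
      ∑[ y < n ] ∑[ x < n ] (A x y * 𝟙 (s y))      ≡⟨ ∑-comm (λ y x → A x y * 𝟙 (s y)) ⟩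
      arcsWith (λ _ y → s y)                       ≡⟨ arcsWith-split (λ _ y → s y) (λ x _ → s x) ⟩
      arcsWith (λ x y → s y ∧ s x) + entering s    ≡⟨ cong (_+ entering s) (sum-cong-≗ (λ x → sum-cong-≗ (λ y →
                                                        cong (λ b → A x y * 𝟙 b) (∧-comm (s y) (s x))))) ⟩
      inside s + entering s                        ∎

  ball : ℕ → Fin n → Fin n → Bool
  ball i v x = does (reach? i v x)

  ball-in : ∀ {i v x} → Reach i v x → ball i v x ≡ true
  ball-in {i} {v} {x} = dec-true (reach? i v x)

  ball-out : ∀ {i v x} → ¬ Reach i v x → ball i v x ≡ false
  ball-out {i} {v} {x} = dec-false (reach? i v x)

  outside : ℕ → Fin n → Fin n → ℕ
  outside i v x = 𝟙 (not (ball i v x))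

  entryRadii exitRadii : ℕ → Fin n → Fin n → Fin n → ℕ
  entryRadii L v x y = ∑[ i < L ] 𝟙 (ball (toℕ i) v y ∧ not (ball (toℕ i) v x))
  exitRadii  L v x y = ∑[ i < L ] 𝟙 (ball (toℕ i) v x ∧ not (ball (toℕ i) v y))

  entries : ℕ → Fin n → ℕ
  entries L v = ∑[ x < n ] ∑[ y < n ] (A x y * entryRadii L v x y)

  -- An arc x → y leaves the growing balls around v at most once: once x is
  -- inside the ball of radius i, y is inside the ball of radius i + 1.
  exitRadii≤1 : ∀ L v {x y} → Arc x y → exitRadii L v x y ≤ 1
  exitRadii≤1 L v {x} {y} xy =
    ≤-trans (m≤m+n _ _) (≤-trans (telescope L _ (λ i → 𝟙 (ball i v y)) exit-step) (𝟙≤1 _))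
    where
    exit-step : ∀ i → 𝟙 (ball i v x ∧ not (ball i v y)) + 𝟙 (ball i v y) ≤ 𝟙 (ball (suc i) v y)
    exit-step i with reach? i v x
    ... | yes vx rewrite ball-in (reach-snoc vx xy) = ≤-reflexive (𝟙-not+𝟙 (ball i v y))
    ... | no _ with reach? i v y
    ...   | yes vy rewrite ball-in {suc i} (reach-weaken (n≤1+n i) vy) = ≤-refl
    ...   | no _ = z≤n

  per-radius : ∀ L (P : ℕ → Fin n → Fin n → Bool) →
               ∑[ x < n ] ∑[ y < n ] (A x y * ∑[ i < L ] 𝟙 (P (toℕ i) x y)) ≡ ∑[ i < L ] arcsWith (P (toℕ i))
  per-radius L P = trans (sum-cong-≗ {n} (λ x → sum-cong-≗ {n} (λ y → distrib x y)))
                         (∑-rotate {n} {n} {L} (λ x y i → A x y * 𝟙 (P (toℕ i) x y)))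
    where
    distrib : ∀ x y → A x y * ∑[ i < L ] 𝟙 (P (toℕ i) x y) ≡ ∑[ i < L ] (A x y * 𝟙 (P (toℕ i) x y))
    distrib x y = *-distribˡ-sum {L} (A x y) (λ i → 𝟙 (P (toℕ i) x y))

  -- Upper bound: at each radius the entering arcs are as many as the leaving
  -- ones, and every arc leaves at most once, so entries L v ≤ m.
  entries≤arcCount : Eulerian G → ∀ L v → entries L v ≤ arcCount
  entries≤arcCount eul L v = begin
    entries L v                                           ≡⟨ per-radius L (λ i x y → ball i v y ∧ not (ball i v x)) ⟩
    ∑[ i < L ] entering (ball (toℕ i) v)                  ≡⟨ sum-cong-≗ {L} (λ i → balance eul (ball (toℕ i) v)) ⟩
    ∑[ i < L ] leaving (ball (toℕ i) v)                   ≡⟨ per-radius L (λ i x y → ball i v x ∧ not (ball i v y)) ⟨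
    ∑[ x < n ] ∑[ y < n ] (A x y * exitRadii L v x y)     ≤⟨ ∑-mono-≤ {n} (λ x → ∑-mono-≤ {n} (λ y →
                                                               arc-weight-≤ (exitRadii≤1 L v))) ⟩
    ∑[ x < n ] ∑[ y < n ] (A x y * 1)                     ≡⟨ sum-cong-≗ (λ x → sum-cong-≗ (λ y → *-identityʳ (A x y))) ⟩
    arcCount                                              ∎
    where open ≤-Reasoning

module LowerBound {n : ℕ} (G : Digraph n) (k : ℕ)
  (no-short-closed-walk : ∀ {v y} → Walks.Arc G v y → ¬ Walks.Reach G k y v) where
  open Walks G
  open Counting G

  radii : Fin n → Fin n → Fin n → ℕ
  radii = entryRadii (suc k)

  no-short-return : ∀ {x v i j} → x ≢ v → Reach i v x → Reach j x v → i + j ≤ suc k → ⊥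
  no-short-return x≢v here         _  _             = x≢v refl
  no-short-return x≢v (step va r) r′ (s≤s i+j≤k) = no-short-closed-walk va (reach-weaken i+j≤k (reach-trans r r′))

  -- The arc x → y enters every ball around its head y: y is always inside,
  -- and x would otherwise close a short walk through x → y.
  radii-at-head : ∀ {x y} → Arc x y → radii y x y ≡ suc k
  radii-at-head {x} {y} xy = trans (sum-cong-≗ {suc k} enters) (∑-ones (suc k))
    where
    enters : ∀ (i : Fin (suc k)) → 𝟙 (ball (toℕ i) y y ∧ not (ball (toℕ i) y x)) ≡ 1
    enters i rewrite ball-in {toℕ i} {y} here
                   | ball-out (no-short-closed-walk xy ∘ reach-weaken {toℕ i} (s≤s⁻¹ (Fin.toℕ<n i)))
                   = refl

  -- If v → y then y is in every ball around v of positive radius, so every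
  -- radius i ≥ 1 at which x is outside is an entry radius of x → y.
  misses≤ : ∀ {v x y} → Arc v y → ∑[ i < suc k ] outside (toℕ i) v x ≤ 1 + radii v x y
  misses≤ {v} {x} {y} vy = +-mono-≤ (𝟙≤1 _) (begin
    ∑[ i < k ] outside (suc (toℕ i)) v x                                  ≡⟨ sum-cong-≗ {k} y-inside ⟩
    ∑[ i < k ] 𝟙 (ball (suc (toℕ i)) v y ∧ not (ball (suc (toℕ i)) v x)) ≤⟨ m≤n+m _ _ ⟩
    radii v x y                                                           ∎)
    where
    open ≤-Reasoning
    y-inside : ∀ (i : Fin k) → outside (suc (toℕ i)) v x ≡ 𝟙 (ball (suc (toℕ i)) v y ∧ not (ball (suc (toℕ i)) v x))
    y-inside i rewrite ball-in {suc (toℕ i)} (step vy here) = refl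

  -- Pairing: for distinct in-neighbours x, v of y, at each radius i ≤ k
  -- either x ∉ B_i(v) or v ∉ B_{k−i}(x); summing over i and using misses≤
  -- twice, the arcs x → y and v → y enter the balls around v and x at least
  -- k − 1 times together.
  pairing : ∀ {x v y} → x ≢ v → Arc x y → Arc v y → k ∸ 1 ≤ radii v x y + radii x v y
  pairing {x} {v} {y} x≢v xy vy = m≤n+o⇒m∸n≤o (suc k) 2 (begin
    suc k                                                ≡⟨ ∑-ones (suc k) ⟨
    ∑[ i < suc k ] 1                                     ≤⟨ ∑-mono-≤ {suc k} one-outside ⟩
    ∑[ i < suc k ] (outside (toℕ i) v x + outside (k ∸ toℕ i) x v)
                                                         ≡⟨ ∑-distrib-+ {suc k} (λ i → outside (toℕ i) v x)
                                                                                (λ i → outside (k ∸ toℕ i) x v) ⟩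
    ∑[ i < suc k ] outside (toℕ i) v x + ∑[ i < suc k ] outside (k ∸ toℕ i) x v
                                                         ≡⟨ cong (∑[ i < suc k ] outside (toℕ i) v x +_)
                                                                 (∑-reverse (suc k) (λ j → outside j x v)) ⟩
    ∑[ i < suc k ] outside (toℕ i) v x + ∑[ i < suc k ] outside (toℕ i) x v
                                                         ≤⟨ +-mono-≤ (misses≤ vy) (misses≤ xy) ⟩
    (1 + radii v x y) + (1 + radii x v y)                ≡⟨ cong suc (+-suc (radii v x y) (radii x v y)) ⟩
    2 + (radii v x y + radii x v y)                      ∎)
    where
    open ≤-Reasoning
    one-outside : ∀ (i : Fin (suc k)) → 1 ≤ outside (toℕ i) v x + outside (k ∸ toℕ i) x v
    one-outside i with reach? (toℕ i) v x | reach? (k ∸ toℕ i) x v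
    ... | yes vx | yes xv = ⊥-elim (no-short-return x≢v vx xv
                              (≤-trans (≤-reflexive (m+[n∸m]≡n (s≤s⁻¹ (Fin.toℕ<n i)))) (n≤1+n k)))
    ... | no _   | _      = s≤s z≤n
    ... | yes _  | no _   = ≤-refl

  allEntries inNbrEntries : Fin n → Fin n → ℕ
  allEntries   x y = ∑[ v < n ] radii v x y
  inNbrEntries x y = ∑[ v < n ] (A v y * radii v x y)

  -- The head y is not an in-neighbour of itself and contributes suc k entries.
  head-contribution : ∀ {x y} → Arc x y → suc k + inNbrEntries x y ≤ allEntries x y
  head-contribution {x} {y} xy = subst (λ c → c + inNbrEntries x y ≤ allEntries x y) (radii-at-head xy)
    (∑-single-out y (λ v → 𝟙-weight≤ (adj G v y) (radii v x y))
                    (cong (λ b → 𝟙 b * radii y x y) (loopless G y)))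

  pairing-sum : ∀ {x y} → Arc x y → d⁻ y * (k ∸ 1) ≤ allEntries x y + ∑[ v < n ] (A v y * radii x v y)
  pairing-sum {x} {y} xy = begin
    d⁻ y * (k ∸ 1)                                            ≡⟨ *-distribʳ-sum (k ∸ 1) (λ v → A v y) ⟩
    ∑[ v < n ] (A v y * (k ∸ 1))                              ≤⟨ ∑-except x (λ v v≢x → arc-weight-≤ (pairing (v≢x ∘ sym) xy)) ⟩
    A x y * (k ∸ 1) + ∑[ v < n ] (A v y * (radii v x y + radii x v y))
                                                              ≡⟨ cong₂ _+_ (arc-weight (k ∸ 1) xy) split ⟩
    (k ∸ 1) + (inNbrEntries x y + Z′)                         ≡⟨ +-assoc (k ∸ 1) _ Z′ ⟨
    (k ∸ 1) + inNbrEntries x y + Z′                           ≤⟨ +-monoˡ-≤ Z′ (≤-trans (+-monoˡ-≤ _ k∸1≤1+k)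
                                                                                       (head-contribution xy)) ⟩
    allEntries x y + Z′                                       ∎
    where
    open ≤-Reasoning
    Z′ = ∑[ v < n ] (A v y * radii x v y)
    split : ∑[ v < n ] (A v y * (radii v x y + radii x v y)) ≡ inNbrEntries x y + Z′
    split = trans (sum-cong-≗ {n} (λ v → *-distribˡ-+ (A v y) (radii v x y) (radii x v y)))
                  (∑-distrib-+ (λ v → A v y * radii v x y) (λ v → A v y * radii x v y))
    k∸1≤1+k : k ∸ 1 ≤ suc k
    k∸1≤1+k = ≤-trans (m∸n≤m k 1) (n≤1+n k)

  headEntries : Fin n → ℕ
  headEntries y = ∑[ x < n ] (A x y * allEntries x y)

  swap-in-neighbours : ∀ y → ∑[ x < n ] (A x y * ∑[ v < n ] (A v y * radii x v y))
                             ≡ ∑[ x < n ] (A x y * inNbrEntries x y)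
  swap-in-neighbours y = begin
    ∑[ x < n ] (A x y * ∑[ v < n ] (A v y * radii x v y))     ≡⟨ sum-cong-≗ {n} (λ x →
                                                                   *-distribˡ-sum (A x y) (λ v → A v y * radii x v y)) ⟩
    ∑[ x < n ] ∑[ v < n ] (A x y * (A v y * radii x v y))     ≡⟨ ∑-comm (λ x v → A x y * (A v y * radii x v y)) ⟩
    ∑[ v < n ] ∑[ x < n ] (A x y * (A v y * radii x v y))     ≡⟨ sum-cong-≗ {n} (λ v → sum-cong-≗ {n} (λ x →
                                                                   *-exchange (A x y) (A v y) _)) ⟩
    ∑[ v < n ] ∑[ x < n ] (A v y * (A x y * radii x v y))     ≡⟨ sum-cong-≗ {n} (λ v →
                                                                   *-distribˡ-sum (A v y) (λ x → A x y * radii x v y)) ⟨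
    ∑[ v < n ] (A v y * inNbrEntries v y)                     ∎
    where open ≡-Reasoning

  per-head : ∀ y → (k ∸ 1) * (d⁻ y * d⁻ y) ≤ 2 * headEntries y
  per-head y = begin
    (k ∸ 1) * (d⁻ y * d⁻ y)                                   ≡⟨ rearrange (k ∸ 1) (d⁻ y) ⟩
    d⁻ y * (d⁻ y * (k ∸ 1))                                   ≡⟨ *-distribʳ-sum (d⁻ y * (k ∸ 1)) (λ x → A x y) ⟩
    ∑[ x < n ] (A x y * (d⁻ y * (k ∸ 1)))                     ≤⟨ ∑-mono-≤ {n} (λ x → arc-weight-≤ pairing-sum) ⟩
    ∑[ x < n ] (A x y * (allEntries x y + ∑[ v < n ] (A v y * radii x v y)))
                                                              ≡⟨ sum-cong-≗ {n} (λ x → *-distribˡ-+ (A x y) _ _) ⟩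
    ∑[ x < n ] (A x y * allEntries x y + A x y * ∑[ v < n ] (A v y * radii x v y))
                                                              ≡⟨ ∑-distrib-+ (λ x → A x y * allEntries x y) _ ⟩
    headEntries y + ∑[ x < n ] (A x y * ∑[ v < n ] (A v y * radii x v y))
                                                              ≡⟨ cong (headEntries y +_) (swap-in-neighbours y) ⟩
    headEntries y + ∑[ x < n ] (A x y * inNbrEntries x y)     ≤⟨ +-monoʳ-≤ (headEntries y) (∑-mono-≤ {n} (λ x →
                                                                   arc-weight-≤ (λ xy → ≤-trans (m≤n+m _ (suc k)) (head-contribution xy)))) ⟩
    headEntries y + headEntries y                             ≡⟨ cong (headEntries y +_) (+-identityʳ (headEntries y)) ⟨
    2 * headEntries y                                         ∎
    where
    open ≤-Reasoning
    rearrange : ∀ a d → a * (d * d) ≡ d * (d * a)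
    rearrange = solve-∀

  ∑headEntries : ∑[ y < n ] headEntries y ≡ ∑[ v < n ] entries (suc k) v
  ∑headEntries = begin
    ∑[ y < n ] ∑[ x < n ] (A x y * allEntries x y)            ≡⟨ sum-cong-≗ {n} (λ y → sum-cong-≗ {n} (λ x →
                                                                   *-distribˡ-sum (A x y) (λ v → radii v x y))) ⟩
    ∑[ y < n ] ∑[ x < n ] ∑[ v < n ] (A x y * radii v x y)    ≡⟨ sum-cong-≗ {n} (λ y → ∑-comm (λ x v → A x y * radii v x y)) ⟩
    ∑[ y < n ] ∑[ v < n ] ∑[ x < n ] (A x y * radii v x y)    ≡⟨ ∑-rotate (λ v x y → A x y * radii v x y) ⟨
    ∑[ v < n ] entries (suc k) v                              ∎
    where open ≡-Reasoning

  lower-bound : (k ∸ 1) * ∑[ y < n ] (d⁻ y * d⁻ y) ≤ 2 * ∑[ v < n ] entries (suc k) v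
  lower-bound = begin
    (k ∸ 1) * ∑[ y < n ] (d⁻ y * d⁻ y)     ≡⟨ *-distribˡ-sum (k ∸ 1) (λ y → d⁻ y * d⁻ y) ⟩
    ∑[ y < n ] ((k ∸ 1) * (d⁻ y * d⁻ y))   ≤⟨ ∑-mono-≤ per-head ⟩
    ∑[ y < n ] (2 * headEntries y)         ≡⟨ *-distribˡ-sum 2 headEntries ⟨
    2 * ∑[ y < n ] headEntries y           ≡⟨ cong (2 *_) ∑headEntries ⟩
    2 * ∑[ v < n ] entries (suc k) v       ∎
    where open ≤-Reasoning

  -- Combining the two bounds with Cauchy–Schwarz, m² ≤ n·Σ d⁻(y)²:
  -- a digraph without closed walks of length ≤ suc k has (k − 1)·m ≤ 2n².
  few-arcs : Eulerian G → (k ∸ 1) * arcCount ≤ 2 * (n * n)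
  few-arcs eul = cancel-factor (k ∸ 1) (2 * (n * n)) arcCount (begin
    (k ∸ 1) * m * m                            ≡⟨ *-assoc (k ∸ 1) m m ⟩
    (k ∸ 1) * (m * m)                          ≡⟨ cong (λ z → (k ∸ 1) * (z * z)) ∑d⁻≡arcCount ⟨
    (k ∸ 1) * (∑[ y < n ] d⁻ y * ∑[ y < n ] d⁻ y)
                                               ≤⟨ *-monoʳ-≤ (k ∸ 1) (cauchy-schwarz n d⁻) ⟩
    (k ∸ 1) * (n * ∑[ y < n ] (d⁻ y * d⁻ y))   ≡⟨ *-exchange (k ∸ 1) n _ ⟩
    n * ((k ∸ 1) * ∑[ y < n ] (d⁻ y * d⁻ y))   ≤⟨ *-monoʳ-≤ n lower-bound ⟩
    n * (2 * ∑[ v < n ] entries (suc k) v)     ≤⟨ *-monoʳ-≤ n (*-monoʳ-≤ 2 (∑-mono-≤ (entries≤arcCount eul (suc k)))) ⟩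
    n * (2 * ∑[ v < n ] m)                     ≡⟨ cong (λ z → n * (2 * z)) (∑-const n m) ⟩
    n * (2 * (n * m))                          ≡⟨ rearrange n m ⟩
    2 * (n * n) * m                            ∎)
    where
    open ≤-Reasoning
    m = arcCount
    rearrange : ∀ n m → n * (2 * (n * m)) ≡ 2 * (n * n) * m
    rearrange = solve-∀

-- Either G has a directed cycle of length at most suc k, or (k − 1)·m ≤ 2n²:
-- decide whether some arc v → y is closed up by a walk y ⇝ v of length ≤ k.
short-cycle-or-few-arcs : ∀ {n} (G : Digraph n) → Eulerian G → ∀ k →
  Walks.CycleWithin G (suc k) ⊎ (k ∸ 1) * arcs G ≤ 2 * (n * n)
short-cycle-or-few-arcs G eul k
  with Fin.any? (λ v → Fin.any? (λ y → (adj G v y ≟ᵇ true) ×-dec Walks.reach? G k y v))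
... | yes (v , y , vy , yv) with Walks.cycle-within G _ (Walks.close-up G vy yv)
...   | ℓ , cycle , ℓ≤ = inj₁ (ℓ , cycle , ≤-trans ℓ≤ (s≤s (Walks.length≤ G yv)))
short-cycle-or-few-arcs G eul k | no no-closed-walk =
  inj₂ (subst (λ m → (k ∸ 1) * m ≤ _) (sym (Counting.arcs≡arcCount G))
              (LowerBound.few-arcs G k (λ vy yv → no-closed-walk (_ , _ , vy , yv)) eul))

-- With q = ⌊2n²/m⌋ the bound
-- (q + 1)·m ≤ 2n² fails, so there is a cycle of length ℓ ≤ q + 3, and then
-- ℓ·m ≤ 3m + q·m ≤ 3n² + 2n².
corollary1p3 : ∀ {n} (G : Digraph n) → Eulerian G → 1 ≤ arcs G →
    ∃ λ ℓ → DirectedCycle G ℓ × ℓ * arcs G ≤ 6 * (n * n)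
corollary1p3 {n} G eul 1≤m = conclude (short-cycle-or-few-arcs G eul (2 + q))
  where
  m = arcs G
  instance
    m≢0 : NonZero m
    m≢0 = >-nonZero 1≤m
  q = 2 * (n * n) / m

  conclude : Walks.CycleWithin G (3 + q) ⊎ suc q * m ≤ 2 * (n * n) →
             ∃ λ ℓ → DirectedCycle G ℓ × ℓ * m ≤ 6 * (n * n)
  conclude (inj₂ few) = contradiction few (<⇒≱ (a<[1+a/m]*m (2 * (n * n)) m))
  conclude (inj₁ (ℓ , cycle , ℓ≤3+q)) = ℓ , cycle , (begin
    ℓ * m                          ≤⟨ *-monoˡ-≤ m ℓ≤3+q ⟩
    (3 + q) * m                    ≡⟨ *-distribʳ-+ m 3 q ⟩
    3 * m + q * m                  ≤⟨ +-mono-≤ (*-monoʳ-≤ 3 (Counting.arcs≤n² G)) (m/n*n≤m (2 * (n * n)) m) ⟩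
    3 * (n * n) + 2 * (n * n)      ≡⟨ *-distribʳ-+ (n * n) 3 2 ⟨
    5 * (n * n)                    ≤⟨ *-monoˡ-≤ (n * n) (n≤1+n 5) ⟩
    6 * (n * n)                    ∎)
    where open ≤-Reasoning
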